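{- Let $B_\infty$ be the infinite braid group, with generators $\sigma_i$ ($i\ge 1$) subject to $\sigma_i\sigma_j=\sigma_j\sigma_i$ when $|i-j|>1$ and $\sigma_i\sigma_j\sigma_i=\sigma_j\sigma_i\sigma_j$ when $|i-j|=1$. Let ${\cal F}_X$ be the free group on generators $x_0,x_1,x_2,\ldots$, with the right action of $B_\infty$ by automorphisms given on generators by $(x_i)\sigma_i^{\pm1}=x_{i\pm1}x_i^{ -1}x_{i\mp1}$ and $(x_j)\sigma_i^{\pm1}=x_j$ for $j\ne i$. Let $n\ge0$. If $f\in{\cal F}_X$ leans right at $n$, and $\sigma$ is $\sigma_i$ or $\sigma_i^{ -1}$ for some $i\ge1$ with $\sigma\ne\sigma_n^{ -1}$, then $(f)\sigma$ also leans right at $n$.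
   Context: A word $f\in{\cal F}_X$ leans right at $n$ if its freely reduced form begins either with $x_m$ for some $m>n$, or with $x_n x_m^{ -1}$ for some $m>n$. The action is obtained by transporting, via the isomorphism $\phi:{\cal F}_X\to{\cal F}_G$, $(x_i)\phi=g_0g_1\cdots g_i$, the right action of $B_\infty$ on the free group ${\cal F}_G$ on $g_0,g_1,\ldots$ given by $(g_i)\sigma_i=g_ig_{i+1}g_i^{ -1}$, $(g_{i+1})\sigma_i=g_i$, $(g_j)\sigma_i=g_j$ ($j\ne i,i+1$); i.e. $(f)p=(f)\phi p\phi^{ -1}$. $(f)p$ denotes the image of $f$ under $p$, with $(f)(pq)=((f)p)q$. -}

module Defs where

open import Data.Nat using (ℕ; zero; suc; _<_; _≟_; pred)
open import Data.Bool using (Bool; true; false; not; if_then_else_; _∧_)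
open import Data.Product using (_×_; _,_; ∃-syntax)
open import Data.Sum using (_⊎_)
open import Data.List using (List; []; _∷_; foldr; concatMap; map; reverse)
open import Relation.Binary.PropositionalEquality using (_≡_)
open import Relation.Nullary.Decidable using (does)
open import Data.Bool.Properties using () renaming (_≟_ to _≟ᵇ_)

-- A letter x_m^{+1} is (m , true); x_m^{-1} is (m , false).
Letter : Set
Letter = ℕ × Bool

-- Words in the generators x_0, x_1, ... ; elements of the free group F_X
-- are represented by words, identified up to free reduction.
Word : Set
Word = List Letter

x : ℕ → Letter
x m = (m , true)

x⁻¹ : ℕ → Letter
x⁻¹ m = (m , false)

invL : Letter → Letter
invL (m , e) = (m , not e)

invW : Word → Word
invW w = reverse (map invL w)

isInv : Letter → Letter → Bool
isInv (m , e) (m' , e') = does (m ≟ m') ∧ does (e ≟ᵇ not e')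

consR : Letter → Word → Word
consR l [] = l ∷ []
consR l (l' ∷ w) = if isInv l l' then w else l ∷ l' ∷ w

reduce : Word → Word
reduce = foldr consR []

-- A braid generator σ_i^{+1} is (i , true), σ_i^{-1} is (i , false); i ≥ 1.
BraidLetter : Set
BraidLetter = ℕ × Bool

genImage : BraidLetter → ℕ → Word
genImage (i , true)  j = if does (j ≟ i) then x (suc i) ∷ x⁻¹ i ∷ x (pred i) ∷ [] else x j ∷ []
genImage (i , false) j = if does (j ≟ i) then x (pred i) ∷ x⁻¹ i ∷ x (suc i) ∷ [] else x j ∷ []

letterImage : BraidLetter → Letter → Word
letterImage s (j , true)  = genImage s j
letterImage s (j , false) = invW (genImage s j)

act : BraidLetter → Word → Word
act s f = reduce (concatMap (letterImage s) f)

LeansRight : ℕ → Word → Set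
LeansRight n f =
  (∃[ m ] ∃[ w ] (n < m × reduce f ≡ x m ∷ w))
  ⊎ (∃[ m ] ∃[ w ] (n < m × reduce f ≡ x n ∷ x⁻¹ m ∷ w))

module Submission where

-- Write σ as x_i ↦ x_p x_i⁻¹ x_q with {p , q} = {i − 1 , i + 1}. When the letters of a freely
-- reduced word are replaced by their images, neighbouring images cancel at most one letter
-- (x_q against x_q⁻¹, or x_p⁻¹ against x_p), so the middle letter x_i^∓1 of the image of every
-- x_i^±1 survives. Hence the first letter of the reduced image is determined by the first two
-- letters of the word, and checking the two shapes x_m … and x_n x_m⁻¹ … (m > n) shows that the
-- image still leans right at n; the single exception, x_n … ↦ x_(n−1) x_n⁻¹ …, occurs only for σ = σ_n⁻¹.

open import Defs
open import Data.Nat using (ℕ; _≤_; _<_; zero; suc; pred; _≡ᵇ_)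
open import Data.Nat.Properties
  using (_≟_; ≡ᵇ⇒≡; n<1+n; m<n⇒m<1+n; m<1+n⇒m<n∨m≡n; ≤∧≢⇒<; ≤-pred; <⇒≢; 1+n≢n)
open import Data.Bool using (Bool; true; false; not)
open import Data.Bool.Properties using (not-involutive; T-≡) renaming (_≟_ to _≟ᵇ_)
open import Data.Product using (_×_; _,_; proj₁; proj₂; ∃-syntax; curry)
open import Data.Product.Properties using (≡-dec)
open import Data.Sum using (_⊎_; inj₁; inj₂)
open import Data.List using ([]; _∷_; _++_; [_]; foldr; concatMap; map; reverse)
open import Data.List.Properties
  using (∷-injectiveˡ; ∷-injectiveʳ; foldr-++; unfold-reverse; reverse-map; reverse-involutive;
         map-∘; map-cong; map-id)
open import Data.List.Relation.Unary.Linked using (Linked; []; [-]; _∷_; head; tail)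
open import Data.Empty using (⊥-elim)
open import Function using (_∘_; id; Equivalence)
open import Relation.Nullary using (¬_; Dec; yes; no)
open import Relation.Nullary.Decidable using (_×-dec_; dec-true; dec-false)
open import Relation.Binary.PropositionalEquality hiding ([_])

-- Free reduction

_≟L_ : (a b : Letter) → Dec (a ≡ b)
_≟L_ = ≡-dec _≟_ _≟ᵇ_

invL-involutive : ∀ l → invL (invL l) ≡ l
invL-involutive (m , e) = cong (m ,_) (not-involutive e)

invW-involutive : ∀ w → invW (invW w) ≡ w
invW-involutive w = begin
  reverse (map invL (reverse (map invL w))) ≡⟨ cong reverse (reverse-map invL (map invL w)) ⟩
  reverse (reverse (map invL (map invL w))) ≡⟨ reverse-involutive _ ⟩
  map invL (map invL w)                     ≡⟨ map-∘ w ⟨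
  map (invL ∘ invL) w                       ≡⟨ map-cong invL-involutive w ⟩
  map id w                                  ≡⟨ map-id w ⟩
  w                                         ∎
  where open ≡-Reasoning

invW-∷ : ∀ l w → invW (l ∷ w) ≡ invW w ++ [ invL l ]
invW-∷ l w = unfold-reverse (invL l) (map invL w)

StartsWith : Word → Letter → Set
StartsWith w c = ∃[ t ] w ≡ c ∷ t

startsWith? : ∀ w c → Dec (StartsWith w c)
startsWith? []      c = no λ ()
startsWith? (d ∷ t) c with d ≟L c
... | yes refl = yes (t , refl)
... | no d≢c   = no λ { (_ , refl) → d≢c refl }

isInv-invL : ∀ l → isInv l (invL l) ≡ true
isInv-invL (m , e)
  rewrite dec-true (m ≟ m) refl | dec-true (e ≟ᵇ not (not e)) (sym (not-involutive e)) = refl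

isInv⇒invL : ∀ l c → isInv l c ≡ true → c ≡ invL l
isInv⇒invL (m , e) (m′ , e′) _ with m ≡ᵇ m′ in m≡ᵇm′
isInv⇒invL (m , true)  (m′ , false) _  | true = cong (_, false) (sym (≡ᵇ⇒≡ m m′ (Equivalence.from T-≡ m≡ᵇm′)))
isInv⇒invL (m , false) (m′ , true)  _  | true = cong (_, true)  (sym (≡ᵇ⇒≡ m m′ (Equivalence.from T-≡ m≡ᵇm′)))
isInv⇒invL (m , true)  (m′ , true)  () | true
isInv⇒invL (m , false) (m′ , false) () | true
isInv⇒invL _           _            () | false

consR-invL : ∀ l t → consR l (invL l ∷ t) ≡ t
consR-invL l t rewrite isInv-invL l = refl

consR-≢ : ∀ l v → ¬ StartsWith v (invL l) → consR l v ≡ l ∷ v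
consR-≢ l []      _  = refl
consR-≢ l (c ∷ t) ¬s with isInv l c in isInv≡
... | true  = ⊥-elim (¬s (t , cong (_∷ t) (isInv⇒invL l c isInv≡)))
... | false = refl

Reduced : Word → Set
Reduced = Linked (λ a b → b ≢ invL a)

reduced-head : ∀ {l w} → Reduced (l ∷ w) → ¬ StartsWith w (invL l)
reduced-head red (_ , refl) = head red refl

consR-reduced : ∀ {l w} → Reduced (l ∷ w) → consR l w ≡ l ∷ w
consR-reduced {l} {w} red = consR-≢ l w (reduced-head red)

reduced-consR : ∀ l {v} → Reduced v → Reduced (consR l v)
reduced-consR l {[]}    _   = [-]
reduced-consR l {c ∷ t} red with startsWith? (c ∷ t) (invL l)
... | yes (_ , refl) rewrite consR-invL l t = tail red
... | no ¬s          rewrite consR-≢ l (c ∷ t) ¬s = (λ c≡ → ¬s (t , cong (_∷ t) c≡)) ∷ red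

reduced-reduce : ∀ w → Reduced (reduce w)
reduced-reduce []      = []
reduced-reduce (l ∷ w) = reduced-consR l (reduced-reduce w)

reduce-reduced : ∀ {w} → Reduced w → reduce w ≡ w
reduce-reduced {[]}    _   = refl
reduce-reduced {l ∷ w} red =
  trans (cong (consR l) (reduce-reduced (tail red))) (consR-reduced red)

consR-consR-invL : ∀ l {v} → Reduced v → consR l (consR (invL l) v) ≡ v
consR-consR-invL l {v} red with startsWith? v (invL (invL l))
... | no ¬s rewrite consR-≢ (invL l) v ¬s = consR-invL l v
... | yes (t , refl) rewrite consR-invL (invL l) t | invL-involutive l = consR-reduced red

foldr-consR-invW : ∀ u {v} → Reduced v → foldr consR (foldr consR v (invW u)) u ≡ v
foldr-consR-invW []      red = refl
foldr-consR-invW (l ∷ u) {v} red = begin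
  consR l (foldr consR (foldr consR v (invW (l ∷ u))) u)
    ≡⟨ cong (λ z → consR l (foldr consR z u))
            (trans (cong (foldr consR v) (invW-∷ l u)) (foldr-++ consR v (invW u) [ invL l ])) ⟩
  consR l (foldr consR (foldr consR (consR (invL l) v) (invW u)) u)
    ≡⟨ cong (consR l) (foldr-consR-invW u (reduced-consR (invL l) red)) ⟩
  consR l (consR (invL l) v)
    ≡⟨ consR-consR-invL l red ⟩
  v ∎
  where open ≡-Reasoning

-- Substitutions respecting inverses

module Substitution (img : Letter → Word) (img-invL : ∀ l → img (invL l) ≡ invW (img l)) where

  image : Word → Word
  image w = reduce (concatMap img w)

  image-∷ : ∀ l w → image (l ∷ w) ≡ foldr consR (image w) (img l)
  image-∷ l w = foldr-++ consR [] (img l) (concatMap img w)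

  image-cancel : ∀ l t → image (l ∷ invL l ∷ t) ≡ image t
  image-cancel l t = begin
    image (l ∷ invL l ∷ t)                                 ≡⟨ image-∷ l (invL l ∷ t) ⟩
    foldr consR (image (invL l ∷ t)) (img l)               ≡⟨ cong (λ z → foldr consR z (img l)) (image-∷ (invL l) t) ⟩
    foldr consR (foldr consR (image t) (img (invL l))) (img l)
      ≡⟨ cong (λ u → foldr consR (foldr consR (image t) u) (img l)) (img-invL l) ⟩
    foldr consR (foldr consR (image t) (invW (img l))) (img l)
      ≡⟨ foldr-consR-invW (img l) (reduced-reduce (concatMap img t)) ⟩
    image t                                                ∎
    where open ≡-Reasoning

  image-consR : ∀ l v → image (l ∷ v) ≡ image (consR l v)
  image-consR l v with startsWith? v (invL l)
  ... | yes (t , refl) rewrite consR-invL l t = image-cancel l t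
  ... | no ¬s          rewrite consR-≢ l v ¬s = refl

  image-reduce : ∀ f → image (reduce f) ≡ image f
  image-reduce []      = refl
  image-reduce (l ∷ f) = begin
    image (consR l (reduce f))                ≡⟨ image-consR l (reduce f) ⟨
    image (l ∷ reduce f)                      ≡⟨ image-∷ l (reduce f) ⟩
    foldr consR (image (reduce f)) (img l)    ≡⟨ cong (λ z → foldr consR z (img l)) (image-reduce f) ⟩
    foldr consR (image f) (img l)             ≡⟨ image-∷ l f ⟨
    image (l ∷ f)                             ∎
    where open ≡-Reasoning

-- Adjacent i p q : x_i ↦ x_p x_i⁻¹ x_q is σ_i (ascending) or σ_i⁻¹ (descending).
data Adjacent : ℕ → ℕ → ℕ → Set where
  ascending  : ∀ k → Adjacent (suc k) (suc (suc k)) k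
  descending : ∀ k → Adjacent (suc k) k (suc (suc k))

private
  n≢2+n : ∀ n → n ≢ suc (suc n)
  n≢2+n n = <⇒≢ (m<n⇒m<1+n (n<1+n n))

module _ {i p q : ℕ} where

  adjacent-p≢i : Adjacent i p q → p ≢ i
  adjacent-p≢i (ascending k)  = 1+n≢n
  adjacent-p≢i (descending k) = <⇒≢ (n<1+n k)

  adjacent-q≢i : Adjacent i p q → q ≢ i
  adjacent-q≢i (ascending k)  = <⇒≢ (n<1+n k)
  adjacent-q≢i (descending k) = 1+n≢n

  adjacent-p≢q : Adjacent i p q → p ≢ q
  adjacent-p≢q (ascending k)  = n≢2+n k ∘ sym
  adjacent-p≢q (descending k) = n≢2+n k

  adjacent-<i⇒<p⊎≡p : ∀ {n} → Adjacent i p q → n < i → n < p ⊎ n ≡ p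
  adjacent-<i⇒<p⊎≡p (ascending k)  n<i = inj₁ (m<n⇒m<1+n n<i)
  adjacent-<i⇒<p⊎≡p (descending k) n<i = m<1+n⇒m<n∨m≡n n<i

  adjacent-<q⇒<i : ∀ {n} → Adjacent i p q → (n ≡ i → p ≡ suc i) → n < q → n < i
  adjacent-<q⇒<i (ascending k)  _     n<q = m<n⇒m<1+n n<q
  adjacent-<q⇒<i (descending k) n≡i⇒ n<q = ≤∧≢⇒< (≤-pred n<q) (n≢2+n k ∘ n≡i⇒)

  adjacent-<i⇒<q : ∀ {n} → Adjacent i p q → n < i → n ≢ q → n < q
  adjacent-<i⇒<q (ascending k)  n<i n≢q = ≤∧≢⇒< (≤-pred n<i) n≢q
  adjacent-<i⇒<q (descending k) n<i _   = m<n⇒m<1+n n<i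

  adjacent-<p⇒<i : ∀ {n} → Adjacent i p q → n < p → n ≢ i → n < i
  adjacent-<p⇒<i (ascending k)  n<p n≢i = ≤∧≢⇒< (≤-pred n<p) n≢i
  adjacent-<p⇒<i (descending k) n<p _   = m<n⇒m<1+n n<p

-- The image of a reduced word under a single generator

BeginsRight : ℕ → Word → Set
BeginsRight n v =
  (∃[ m ] ∃[ w ] (n < m × v ≡ x m ∷ w))
  ⊎ (∃[ m ] ∃[ w ] (n < m × v ≡ x n ∷ x⁻¹ m ∷ w))

module Generator
  (img : Letter → Word) {i p q : ℕ} (adjacent : Adjacent i p q)
  (img-fixes : ∀ j → j ≢ i → img (x j) ≡ x j ∷ [])
  (img-moves : img (x i) ≡ x p ∷ x⁻¹ i ∷ x q ∷ [])
  (img-invL : ∀ l → img (invL l) ≡ invW (img l))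
  where

  open Substitution img img-invL

  p≢i : p ≢ i
  p≢i = adjacent-p≢i adjacent

  q≢i : q ≢ i
  q≢i = adjacent-q≢i adjacent

  p≢q : p ≢ q
  p≢q = adjacent-p≢q adjacent

  image-fixed-∷ : ∀ l w → proj₁ l ≢ i → image (l ∷ w) ≡ consR l (image w)
  image-fixed-∷ (j , true)  w j≢i = trans (image-∷ (x j) w) (cong (foldr consR (image w)) (img-fixes j j≢i))
  image-fixed-∷ (j , false) w j≢i =
    trans (image-∷ (x⁻¹ j) w) (cong (foldr consR (image w)) (trans (img-invL (x j)) (cong invW (img-fixes j j≢i))))

  image-x-∷ : ∀ w → image (x i ∷ w) ≡ consR (x p) (consR (x⁻¹ i) (consR (x q) (image w)))
  image-x-∷ w = trans (image-∷ (x i) w) (cong (foldr consR (image w)) img-moves)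

  image-x⁻¹-∷ : ∀ w → image (x⁻¹ i ∷ w) ≡ consR (x⁻¹ q) (consR (x i) (consR (x⁻¹ p) (image w)))
  image-x⁻¹-∷ w =
    trans (image-∷ (x⁻¹ i) w) (cong (foldr consR (image w)) (trans (img-invL (x i)) (cong invW img-moves)))

  Inert : Letter → Word → Set
  Inert h w = proj₁ h ≢ i × (h ≡ x q → ¬ StartsWith w (x⁻¹ i)) × (h ≡ x⁻¹ p → ¬ StartsWith w (x i))

  data Pattern : Letter → Word → Set where
    xᵢ       : ∀ w → Pattern (x i) w
    xᵢ⁻¹     : ∀ w → Pattern (x⁻¹ i) w
    x_q·xᵢ⁻¹ : ∀ w → Pattern (x q) (x⁻¹ i ∷ w)
    x_p⁻¹·xᵢ : ∀ w → Pattern (x⁻¹ p) (x i ∷ w)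
    other    : ∀ {h w} → Inert h w → Pattern h w

  classify : ∀ h w → Pattern h w
  classify (j , e) w with j ≟ i
  classify (j , true)  w | yes refl = xᵢ w
  classify (j , false) w | yes refl = xᵢ⁻¹ w
  classify (j , e) w | no j≢i
    with ((j , e) ≟L x q) ×-dec startsWith? w (x⁻¹ i) | ((j , e) ≟L x⁻¹ p) ×-dec startsWith? w (x i)
  ... | yes (refl , w′ , refl) | _                      = x_q·xᵢ⁻¹ w′
  ... | no _                   | yes (refl , w′ , refl) = x_p⁻¹·xᵢ w′
  ... | no ¬q                  | no ¬p                  = other (j≢i , curry ¬q , curry ¬p)

  lead : ∀ {h w} → Pattern h w → Letter
  lead (xᵢ _)       = x p
  lead (xᵢ⁻¹ _)     = x⁻¹ q
  lead (x_q·xᵢ⁻¹ _) = x i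
  lead (x_p⁻¹·xᵢ _) = x⁻¹ i
  lead {h} (other _) = h

  image-xᵢ             : ∀ w → Reduced (x i ∷ w) → ∃[ t ] image (x i ∷ w) ≡ x p ∷ x⁻¹ i ∷ t
  image-xᵢ⁻¹           : ∀ w → Reduced (x⁻¹ i ∷ w) → ∃[ t ] image (x⁻¹ i ∷ w) ≡ x⁻¹ q ∷ x i ∷ t
  image-x_q·xᵢ⁻¹       : ∀ w → Reduced (x q ∷ x⁻¹ i ∷ w) → StartsWith (image (x q ∷ x⁻¹ i ∷ w)) (x i)
  image-x_p⁻¹·xᵢ       : ∀ w → Reduced (x⁻¹ p ∷ x i ∷ w) → StartsWith (image (x⁻¹ p ∷ x i ∷ w)) (x⁻¹ i)
  image-inert          : ∀ {h w} → Reduced (h ∷ w) → Inert h w → image (h ∷ w) ≡ h ∷ image w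
  image-lead           : ∀ {h w} → Reduced (h ∷ w) → (π : Pattern h w) → StartsWith (image (h ∷ w)) (lead π)
  image-starts-xᵢ      : ∀ {w} → Reduced w → StartsWith (image w) (x i) → StartsWith w (x q)
  image-starts-xᵢ⁻¹    : ∀ {w} → Reduced w → StartsWith (image w) (x⁻¹ i) → StartsWith w (x⁻¹ p)
  image-starts-other   : ∀ {w c} → Reduced w → proj₁ c ≢ i → StartsWith (image w) c
                       → (c ≡ x p × StartsWith w (x i)) ⊎ (c ≡ x⁻¹ q × StartsWith w (x⁻¹ i)) ⊎ StartsWith w c
  xᵢ-middle-survives   : ∀ w → Reduced (x i ∷ w) → ¬ StartsWith (consR (x q) (image w)) (x i)
  xᵢ⁻¹-middle-survives : ∀ w → Reduced (x⁻¹ i ∷ w) → ¬ StartsWith (consR (x⁻¹ p) (image w)) (x⁻¹ i)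

  image-xᵢ w red = u , (begin
    image (x i ∷ w)                      ≡⟨ image-x-∷ w ⟩
    consR (x p) (consR (x⁻¹ i) u)        ≡⟨ cong (consR (x p)) (consR-≢ (x⁻¹ i) u (xᵢ-middle-survives w red)) ⟩
    consR (x p) (x⁻¹ i ∷ u)              ≡⟨ consR-≢ (x p) (x⁻¹ i ∷ u) (λ (_ , e) → p≢i (sym (cong proj₁ (∷-injectiveˡ e)))) ⟩
    x p ∷ x⁻¹ i ∷ u                      ∎)
    where
    u : Word
    u = consR (x q) (image w)
    open ≡-Reasoning

  image-xᵢ⁻¹ w red = u , (begin
    image (x⁻¹ i ∷ w)                    ≡⟨ image-x⁻¹-∷ w ⟩
    consR (x⁻¹ q) (consR (x i) u)        ≡⟨ cong (consR (x⁻¹ q)) (consR-≢ (x i) u (xᵢ⁻¹-middle-survives w red)) ⟩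
    consR (x⁻¹ q) (x i ∷ u)              ≡⟨ consR-≢ (x⁻¹ q) (x i ∷ u) (λ (_ , e) → q≢i (sym (cong proj₁ (∷-injectiveˡ e)))) ⟩
    x⁻¹ q ∷ x i ∷ u                      ∎)
    where
    u : Word
    u = consR (x⁻¹ p) (image w)
    open ≡-Reasoning

  image-x_q·xᵢ⁻¹ w red with image-xᵢ⁻¹ w (tail red)
  ... | t , eq = t , (begin
    image (x q ∷ x⁻¹ i ∷ w)             ≡⟨ image-fixed-∷ (x q) (x⁻¹ i ∷ w) q≢i ⟩
    consR (x q) (image (x⁻¹ i ∷ w))     ≡⟨ cong (consR (x q)) eq ⟩
    consR (x q) (x⁻¹ q ∷ x i ∷ t)       ≡⟨ consR-invL (x q) (x i ∷ t) ⟩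
    x i ∷ t                             ∎)
    where open ≡-Reasoning

  image-x_p⁻¹·xᵢ w red with image-xᵢ w (tail red)
  ... | t , eq = t , (begin
    image (x⁻¹ p ∷ x i ∷ w)             ≡⟨ image-fixed-∷ (x⁻¹ p) (x i ∷ w) p≢i ⟩
    consR (x⁻¹ p) (image (x i ∷ w))     ≡⟨ cong (consR (x⁻¹ p)) eq ⟩
    consR (x⁻¹ p) (x p ∷ x⁻¹ i ∷ t)     ≡⟨ consR-invL (x⁻¹ p) (x⁻¹ i ∷ t) ⟩
    x⁻¹ i ∷ t                           ∎)
    where open ≡-Reasoning

  image-inert {h} {w} red (h≢i , ¬q , ¬p) =
    trans (image-fixed-∷ h w h≢i) (consR-≢ h (image w) image-avoids-h⁻¹)
    where
    h≡⁻¹ : ∀ {c} → invL h ≡ c → h ≡ invL c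
    h≡⁻¹ h⁻¹≡c = trans (sym (invL-involutive h)) (cong invL h⁻¹≡c)

    image-avoids-h⁻¹ : ¬ StartsWith (image w) (invL h)
    image-avoids-h⁻¹ s with image-starts-other (tail red) h≢i s
    ... | inj₁ (h⁻¹≡xp , sw)          = ¬p (h≡⁻¹ h⁻¹≡xp) sw
    ... | inj₂ (inj₁ (h⁻¹≡x⁻¹q , sw)) = ¬q (h≡⁻¹ h⁻¹≡x⁻¹q) sw
    ... | inj₂ (inj₂ sw)              = reduced-head red sw

  image-lead red (xᵢ w)       = _ , proj₂ (image-xᵢ w red)
  image-lead red (xᵢ⁻¹ w)     = _ , proj₂ (image-xᵢ⁻¹ w red)
  image-lead red (x_q·xᵢ⁻¹ w) = image-x_q·xᵢ⁻¹ w red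
  image-lead red (x_p⁻¹·xᵢ w) = image-x_p⁻¹·xᵢ w red
  image-lead red (other inert) = _ , image-inert red inert

  image-starts-xᵢ {[]} _ (_ , ())
  image-starts-xᵢ {h ∷ w} red (t , eq) with classify h w
  ... | π with ∷-injectiveˡ (trans (sym eq) (proj₂ (image-lead red π)))
  image-starts-xᵢ red _ | xᵢ w               | xᵢ≡xₚ = ⊥-elim (p≢i (sym (cong proj₁ xᵢ≡xₚ)))
  image-starts-xᵢ red _ | x_q·xᵢ⁻¹ w         | _     = _ , refl
  image-starts-xᵢ red _ | other (h≢i , _)    | refl  = ⊥-elim (h≢i refl)

  image-starts-xᵢ⁻¹ {[]} _ (_ , ())
  image-starts-xᵢ⁻¹ {h ∷ w} red (t , eq) with classify h w
  ... | π with ∷-injectiveˡ (trans (sym eq) (proj₂ (image-lead red π)))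
  image-starts-xᵢ⁻¹ red _ | xᵢ⁻¹ w            | xᵢ≡x_q = ⊥-elim (q≢i (sym (cong proj₁ xᵢ≡x_q)))
  image-starts-xᵢ⁻¹ red _ | x_p⁻¹·xᵢ w        | _      = _ , refl
  image-starts-xᵢ⁻¹ red _ | other (h≢i , _)   | refl   = ⊥-elim (h≢i refl)

  image-starts-other {[]} _ _ (_ , ())
  image-starts-other {h ∷ w} red c≢i (t , eq) with classify h w
  ... | π with ∷-injectiveˡ (trans (sym eq) (proj₂ (image-lead red π)))
  image-starts-other red c≢i _ | xᵢ w       | c≡xp   = inj₁ (c≡xp , _ , refl)
  image-starts-other red c≢i _ | xᵢ⁻¹ w     | c≡x⁻¹q = inj₂ (inj₁ (c≡x⁻¹q , _ , refl))
  image-starts-other red c≢i _ | x_q·xᵢ⁻¹ w | refl   = ⊥-elim (c≢i refl)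
  image-starts-other red c≢i _ | x_p⁻¹·xᵢ w | refl   = ⊥-elim (c≢i refl)
  image-starts-other red c≢i _ | other _    | refl   = inj₂ (inj₂ (_ , refl))

  -- If x_q cancels, the word continues x⁻¹ q w′ and x_i cannot lead the image of w′.
  xᵢ-middle-survives w red (t , eq) with startsWith? (image w) (x⁻¹ q)
  ... | no ¬s = q≢i (cong proj₁ (∷-injectiveˡ (trans (sym (consR-≢ (x q) (image w) ¬s)) eq)))
  ... | yes (t′ , image≡) with image-starts-other (tail red) q≢i (t′ , image≡)
  ...   | inj₂ (inj₁ (_ , sw)) = reduced-head red sw
  ...   | inj₂ (inj₂ (w′ , refl)) =
    reduced-head (tail red) (image-starts-xᵢ (tail (tail red)) (t , trans (∷-injectiveʳ image≡′) t′≡))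
    where
    image≡′ : x⁻¹ q ∷ image w′ ≡ x⁻¹ q ∷ t′
    image≡′ = trans (sym (image-inert (tail red) (q≢i , (λ ()) , λ e _ → p≢q (sym (cong proj₁ e))))) image≡
    t′≡ : t′ ≡ x i ∷ t
    t′≡ = trans (sym (consR-invL (x q) t′)) (trans (cong (consR (x q)) (sym image≡)) eq)

  xᵢ⁻¹-middle-survives w red (t , eq) with startsWith? (image w) (x p)
  ... | no ¬s = p≢i (cong proj₁ (∷-injectiveˡ (trans (sym (consR-≢ (x⁻¹ p) (image w) ¬s)) eq)))
  ... | yes (t′ , image≡) with image-starts-other (tail red) p≢i (t′ , image≡)
  ...   | inj₁ (_ , sw) = reduced-head red sw
  ...   | inj₂ (inj₂ (w′ , refl)) =
    reduced-head (tail red) (image-starts-xᵢ⁻¹ (tail (tail red)) (t , trans (∷-injectiveʳ image≡′) t′≡))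
    where
    image≡′ : x p ∷ image w′ ≡ x p ∷ t′
    image≡′ = trans (sym (image-inert (tail red) (p≢i , (λ e _ → p≢q (cong proj₁ e)) , λ ()))) image≡
    t′≡ : t′ ≡ x⁻¹ i ∷ t
    t′≡ = trans (sym (consR-invL (x⁻¹ p) t′)) (trans (cong (consR (x⁻¹ p)) (sym image≡)) eq)

  image-beginsRight-x : ∀ {n m w} → (n ≡ i → p ≡ suc i) → n < m → Reduced (x m ∷ w)
                      → BeginsRight n (image (x m ∷ w))
  image-beginsRight-x {m = m} {w} allowed n<m red with classify (x m) w
  ... | xᵢ _ with image-xᵢ w red
  ...   | t , eq with adjacent-<i⇒<p⊎≡p adjacent n<m
  ...     | inj₁ n<p  = inj₁ (p , _ , n<p , eq)
  ...     | inj₂ refl = inj₂ (i , t , n<m , eq)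
  image-beginsRight-x allowed n<m red | x_q·xᵢ⁻¹ w =
    inj₁ (i , _ , adjacent-<q⇒<i adjacent allowed n<m , proj₂ (image-x_q·xᵢ⁻¹ w red))
  image-beginsRight-x allowed n<m red | other inert =
    inj₁ (_ , _ , n<m , image-inert red inert)

  image-beginsRight-x-x⁻¹ : ∀ {n m w} → (n ≡ i → p ≡ suc i) → n < m → Reduced (x n ∷ x⁻¹ m ∷ w)
                          → BeginsRight n (image (x n ∷ x⁻¹ m ∷ w))
  image-beginsRight-x-x⁻¹ {n} {m} {w} allowed n<m red with classify (x n) (x⁻¹ m ∷ w)
  ... | xᵢ _       = inj₁ (p , _ , subst (i <_) (sym (allowed refl)) (n<1+n i) , proj₂ (image-xᵢ _ red))
  ... | x_q·xᵢ⁻¹ _ = inj₁ (i , _ , n<m , proj₂ (image-x_q·xᵢ⁻¹ w red))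
  ... | other inert@(n≢i , ¬q , _) with classify (x⁻¹ m) w
  ...   | xᵢ⁻¹ _ =
    inj₂ (q , _ , adjacent-<i⇒<q adjacent n<m (λ n≡q → ¬q (cong x n≡q) (w , refl)) ,
          trans (image-inert red inert) (cong (x n ∷_) (proj₂ (image-xᵢ⁻¹ w (tail red)))))
  ...   | x_p⁻¹·xᵢ w′ =
    inj₂ (i , _ , adjacent-<p⇒<i adjacent n<m n≢i ,
          trans (image-inert red inert) (cong (x n ∷_) (proj₂ (image-x_p⁻¹·xᵢ w′ (tail red)))))
  ...   | other inert′ =
    inj₂ (_ , _ , n<m , trans (image-inert red inert) (cong (x n ∷_) (image-inert (tail red) inert′)))

  image-beginsRight : ∀ {n v} → (n ≡ i → p ≡ suc i) → Reduced v → BeginsRight n v → BeginsRight n (image v)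
  image-beginsRight allowed red (inj₁ (_ , _ , n<m , refl)) = image-beginsRight-x allowed n<m red
  image-beginsRight allowed red (inj₂ (_ , _ , n<m , refl)) = image-beginsRight-x-x⁻¹ allowed n<m red

  image-leansRight : ∀ {n} f → (n ≡ i → p ≡ suc i) → LeansRight n f → LeansRight n (image f)
  image-leansRight {n} f allowed leans =
    subst (BeginsRight n) (sym reduce-image) (image-beginsRight allowed (reduced-reduce f) leans)
    where
    reduce-image : reduce (image f) ≡ image (reduce f)
    reduce-image = trans (reduce-reduced (reduced-reduce (concatMap img f))) (sym (image-reduce f))

genImage-fixes : ∀ s j → j ≢ proj₁ s → genImage s j ≡ x j ∷ []
genImage-fixes (i , true)  j j≢i rewrite dec-false (j ≟ i) j≢i = refl
genImage-fixes (i , false) j j≢i rewrite dec-false (j ≟ i) j≢i = refl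

genImage-σ : ∀ i → genImage (i , true) i ≡ x (suc i) ∷ x⁻¹ i ∷ x (pred i) ∷ []
genImage-σ i rewrite dec-true (i ≟ i) refl = refl

genImage-σ⁻¹ : ∀ i → genImage (i , false) i ≡ x (pred i) ∷ x⁻¹ i ∷ x (suc i) ∷ []
genImage-σ⁻¹ i rewrite dec-true (i ≟ i) refl = refl

letterImage-invL : ∀ s l → letterImage s (invL l) ≡ invW (letterImage s l)
letterImage-invL s (j , true)  = refl
letterImage-invL s (j , false) = sym (invW-involutive (genImage s j))

module Ascending (k : ℕ) =
  Generator (letterImage (suc k , true)) (ascending k)
    (genImage-fixes (suc k , true)) (genImage-σ (suc k)) (letterImage-invL (suc k , true))

module Descending (k : ℕ) =
  Generator (letterImage (suc k , false)) (descending k)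
    (genImage-fixes (suc k , false)) (genImage-σ⁻¹ (suc k)) (letterImage-invL (suc k , false))

mainTheorem3 : (n : ℕ) (f : Word) (i : ℕ) (e : Bool)
    → 1 ≤ i
    → ¬ ((i , e) ≡ (n , false))
    → LeansRight n f
    → LeansRight n (act (i , e) f)
mainTheorem3 n f zero    _     () _
mainTheorem3 n f (suc k) true  _  _      = Ascending.image-leansRight k f (λ _ → refl)
mainTheorem3 n f (suc k) false _  σ≢σₙ⁻¹ =
  Descending.image-leansRight k f (λ n≡i → ⊥-elim (σ≢σₙ⁻¹ (cong (_, false) (sym n≡i))))
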